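{- Let $s\ge 2$ and let $G=K(n_1,\dots,n_s)$ be a complete $s$-partite graph with $1\le n_j\le 2$ for all $j\in\{1,\dots,s\}$. Then $\chi_3(G)=\left\lceil \frac{n_1+n_2+\cdots+n_s}{4}\right\rceil$.
   Context: $K(n_1,\dots,n_s)$ denotes the complete $s$-partite graph whose parts have $n_1,\dots,n_s$ vertices. A $3$-relaxed $k$-coloring is a map $f:V\to\{1,\dots,k\}$ such that every vertex $u$ has at most $3$ neighbors $v$ with $f(v)=f(u)$; $\chi_3(G)$ is the minimum such $k$. -}

module Defs where

open import Data.Nat using (ℕ; zero; suc; _+_; _≤_; _<_; _/_)
open import Data.Fin using (Fin)
open import Data.Fin.Properties using () renaming (_≟_ to _≟ᶠ_)
open import Data.Product using (Σ; _,_; proj₁; _×_)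
open import Data.List using (List; length; filter; concatMap; map; allFin)
open import Data.Nat.ListAction using (sum)
open import Relation.Nullary using (¬_; Dec)
open import Relation.Nullary.Decidable using (_×-dec_; ¬?)
open import Relation.Binary.PropositionalEquality using (_≡_)

-- Complete s-partite graph K(n₁,…,nₛ), part sizes given by  n : Fin s → ℕ.
-- A vertex is a pair (j , i) : part j, index i within part j.
Vertex : (s : ℕ) → (Fin s → ℕ) → Set
Vertex s n = Σ (Fin s) (λ j → Fin (n j))

vertices : (s : ℕ) (n : Fin s → ℕ) → List (Vertex s n)
vertices s n = concatMap (λ j → map (λ i → (j , i)) (allFin (n j))) (allFin s)

Adj : (s : ℕ) (n : Fin s → ℕ) → Vertex s n → Vertex s n → Set
Adj s n u v = ¬ (proj₁ u ≡ proj₁ v)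

sameColourNeighbours : (s : ℕ) (n : Fin s → ℕ) {k : ℕ} →
  (Vertex s n → Fin k) → Vertex s n → ℕ
sameColourNeighbours s n f u =
  length (filter (λ v → ¬? (proj₁ u ≟ᶠ proj₁ v) ×-dec (f v ≟ᶠ f u)) (vertices s n))

Is3RelaxedColouring : (s : ℕ) (n : Fin s → ℕ) (k : ℕ) → (Vertex s n → Fin k) → Set
Is3RelaxedColouring s n k f = ∀ u → sameColourNeighbours s n f u ≤ 3

Has3RelaxedColouring : (s : ℕ) (n : Fin s → ℕ) (k : ℕ) → Set
Has3RelaxedColouring s n k = Σ (Vertex s n → Fin k) (Is3RelaxedColouring s n k)

Chi3≡ : (s : ℕ) (n : Fin s → ℕ) (k : ℕ) → Set
Chi3≡ s n k = Has3RelaxedColouring s n k × (∀ m → m < k → ¬ Has3RelaxedColouring s n m)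

totalSize : (s : ℕ) → (Fin s → ℕ) → ℕ
totalSize s n = sum (map n (allFin s))

ceil4 : ℕ → ℕ
ceil4 m = (m + 3) / 4

module Submission where

-- Listing the vertices part by part as 0, 1, …, N − 1 and colouring by ⌊index / 4⌋ gives
-- classes of at most four vertices; a vertex u has as many same-coloured neighbours as its
-- class has members outside u's part, hence at most 4 − 1 = 3.
-- Conversely, in a 3-relaxed colouring a class containing u has at most 3 members outside
-- u's part and at most 2 inside, so at most 5 in all.  A class of exactly 5 would meet every
-- part in 0 or 2 vertices (a single member of a part would have 4 same-coloured neighbours),
-- contradicting the oddness of 5.  Thus every class has at most 4 vertices and N ≤ 4k.

open import Defs
open import Data.Fin using (Fin; zero; suc; toℕ; fromℕ<)
open import Data.Fin.Properties using (toℕ-fromℕ<; toℕ-injective; toℕ<n; punchInᵢ≢i)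
  renaming (_≟_ to _≟ᶠ_)
open import Data.List using (List; []; _∷_; _++_; length; filter; map; concat; allFin; tabulate; applyUpTo; upTo)
open import Data.List.Properties
  using (length-++; length-map; length-filter; length-tabulate; length-applyUpTo; map-++; map-∘; map-tabulate;
         map-concatMap; map-cong; filter-++; filter-≐; filter-none; filter-accept; filter-reject; filter-some)
open import Data.List.Membership.Propositional using (lose)
open import Data.List.Membership.Propositional.Properties using (∈-allFin)
open import Data.List.Relation.Unary.All using (universal)
open import Data.List.Relation.Unary.Any using (Any; here; there; satisfied)
open import Data.Nat using (ℕ; NonZero; zero; suc; pred; _+_; _*_; _∸_; _≤_; _<_; _/_; _%_; z≤n; s≤s; s≤s⁻¹)
open import Data.Nat.Properties
open import Algebra.Properties.CommutativeMonoid.Sum +-0-commutativeMonoid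
  using (sum-remove; sum-cong-≗; sum-replicate-zero) renaming (sum to ∑)
open import Data.Nat.DivMod using (m≡m%n+[m/n]*n; m%n<n; m/n*n≤m; m<n*o⇒m/o<n)
open import Data.Nat.Divisibility using (_∣_; _∣?_; _∣0; ∣-refl; ∣m∣n⇒∣m+n)
open import Data.Nat.ListAction using (sum)
open import Data.Product using (_×_; _,_; proj₁; proj₂)
import Data.Product as Product
open import Data.Vec.Functional using (removeAt)
open import Function using (_∘_; id)
open import Relation.Nullary using (¬_; yes; no)
open import Relation.Nullary.Decidable using (from-no; ¬?; _×-dec_)
open import Relation.Unary using (Decidable; _≐_)
open import Relation.Binary.PropositionalEquality

module _ {A : Set} {P : A → Set} (P? : Decidable P) where

  filter-some⁻ : ∀ xs → 0 < length (filter P? xs) → Any P xs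
  filter-some⁻ (x ∷ xs) nonempty with P? x
  ... | yes px = here px
  ... | no  _  = there (filter-some⁻ xs nonempty)

  length-filter-++ : ∀ xs ys →
    length (filter P? (xs ++ ys)) ≡ length (filter P? xs) + length (filter P? ys)
  length-filter-++ xs ys = trans (cong length (filter-++ P? xs ys)) (length-++ (filter P? xs))

  length-filter-map : ∀ {B : Set} (g : B → A) xs →
    length (filter P? (map g xs)) ≡ length (filter (P? ∘ g) xs)
  length-filter-map g [] = refl
  length-filter-map g (x ∷ xs) with P? (g x)
  ... | yes _ = cong suc (length-filter-map g xs)
  ... | no  _ = length-filter-map g xs

  length-filter-applyUpTo-≤ : ∀ (f : ℕ → A) L a b → (∀ i → P (f i) → a ≤ i × i < b) →
    length (filter P? (applyUpTo f L)) ≤ b ∸ a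
  length-filter-applyUpTo-≤ f zero a b window = z≤n
  -- Dropping the head of the list shifts the window [a, b) to [a − 1, b − 1).
  length-filter-applyUpTo-≤ f (suc L) a b window
    with P? (f 0)
       | length-filter-applyUpTo-≤ (f ∘ suc) L (pred a) (pred b)
           (λ i → Product.map pred-mono-≤ pred-mono-≤ ∘ window (suc i))
  ... | yes p | ih with window 0 p
  ...   | z≤n , s≤s _ = s≤s ih
  length-filter-applyUpTo-≤ f (suc L) a b window | no _ | ih = ≤-trans ih (pred∸pred≤∸ a b)
    where
    pred∸pred≤∸ : ∀ a b → pred b ∸ pred a ≤ b ∸ a
    pred∸pred≤∸ zero    b       = pred[n]≤n
    pred∸pred≤∸ (suc a) zero    = ≤-reflexive (0∸n≡0 a)
    pred∸pred≤∸ (suc a) (suc b) = ≤-refl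

∑-differ-at : ∀ {s} (a : Fin s) {g h : Fin s → ℕ} → (∀ j → j ≢ a → g j ≡ h j) →
  ∑ g + h a ≡ ∑ h + g a
∑-differ-at {suc s} a {g} {h} agree = begin
  ∑ g + h a                      ≡⟨ cong (_+ h a) (sum-remove {i = a} g) ⟩
  g a + ∑ (removeAt g a) + h a   ≡⟨ cong (λ r → g a + r + h a) (sum-cong-≗ (λ j → agree _ (punchInᵢ≢i a j))) ⟩
  g a + ∑ (removeAt h a) + h a   ≡⟨ swap (g a) (∑ (removeAt h a)) (h a) ⟩
  h a + ∑ (removeAt h a) + g a   ≡⟨ cong (_+ g a) (sum-remove {i = a} h) ⟨
  ∑ h + g a                      ∎
  where
  open ≡-Reasoning
  swap : ∀ x r y → x + r + y ≡ y + r + x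
  swap x r y = trans (+-comm (x + r) y) (trans (cong (y +_) (+-comm x r)) (sym (+-assoc y r x)))

∑-≤-* : ∀ {s} (g : Fin s → ℕ) {b} → (∀ j → g j ≤ b) → ∑ g ≤ s * b
∑-≤-* {zero}  g bound = z≤n
∑-≤-* {suc s} g bound = +-mono-≤ (bound zero) (∑-≤-* (g ∘ suc) (bound ∘ suc))

∣-∑ : ∀ {s} {d} (g : Fin s → ℕ) → (∀ j → d ∣ g j) → d ∣ ∑ g
∣-∑ {zero}  {d} g divides = d ∣0
∣-∑ {suc s}     g divides = ∣m∣n⇒∣m+n (divides zero) (∣-∑ (g ∘ suc) (divides ∘ suc))

sum-map-allFin : ∀ s (g : Fin s → ℕ) → sum (map g (allFin s)) ≡ ∑ g
sum-map-allFin zero    g = refl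
sum-map-allFin (suc s) g = cong (g zero +_) (begin
  sum (map g (tabulate suc))      ≡⟨ cong sum (map-tabulate suc g) ⟩
  sum (tabulate (g ∘ suc))        ≡⟨ cong sum (map-tabulate id (g ∘ suc)) ⟨
  sum (map (g ∘ suc) (allFin s))  ≡⟨ sum-map-allFin s (g ∘ suc) ⟩
  ∑ (g ∘ suc)                     ∎)
  where open ≡-Reasoning

length≡∑-fibres : ∀ {A : Set} {k} (f : A → Fin k) xs →
  length xs ≡ ∑ (λ c → length (filter (λ x → f x ≟ᶠ c) xs))
length≡∑-fibres {k = k} f [] = sym (sum-replicate-zero k)
length≡∑-fibres {k = k} f (x ∷ xs) = begin
  suc (length xs)    ≡⟨ cong suc (length≡∑-fibres f xs) ⟩
  suc (∑ fibre)      ≡⟨ +-cancelʳ-≡ _ _ _ (trans (sym (+-suc (∑ fibre) _)) differ) ⟩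
  ∑ fibre′           ∎
  where
  open ≡-Reasoning
  fibre fibre′ : Fin k → ℕ
  fibre  c = length (filter (λ y → f y ≟ᶠ c) xs)
  fibre′ c = length (filter (λ y → f y ≟ᶠ c) (x ∷ xs))
  differ : ∑ fibre + suc (fibre (f x)) ≡ ∑ fibre′ + fibre (f x)
  differ = trans (cong (∑ fibre +_) (sym (cong length (filter-accept (λ y → f y ≟ᶠ f x) refl))))
                 (∑-differ-at (f x) (λ c c≢fx → sym (cong length (filter-reject (λ y → f y ≟ᶠ c) (c≢fx ∘ sym)))))

2∣-of-≤2 : ∀ {m} → m ≤ 2 → (0 < m → 2 ≤ m) → 2 ∣ m
2∣-of-≤2 {0}                 _               _   = 2 ∣0
2∣-of-≤2 {1}                 _               gap with gap (s≤s z≤n)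
... | s≤s ()
2∣-of-≤2 {2}                 _               _   = ∣-refl
2∣-of-≤2 {suc (suc (suc _))} (s≤s (s≤s ())) _

≤ceil4*4 : ∀ m → m ≤ ceil4 m * 4
≤ceil4*4 m = +-cancelʳ-≤ 3 m (ceil4 m * 4) (begin
  m + 3                          ≡⟨ m≡m%n+[m/n]*n (m + 3) 4 ⟩
  (m + 3) % 4 + ceil4 m * 4      ≤⟨ +-monoˡ-≤ _ (s≤s⁻¹ (m%n<n (m + 3) 4)) ⟩
  3 + ceil4 m * 4                ≡⟨ +-comm 3 _ ⟩
  ceil4 m * 4 + 3                ∎)
  where open ≤-Reasoning

ceil4-least : ∀ {m k} → m ≤ k * 4 → ceil4 m ≤ k
ceil4-least {m} {k} m≤k*4 = s≤s⁻¹ (m<n*o⇒m/o<n {m + 3} {suc k} {4} (begin-strict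
  m + 3           ≤⟨ +-monoˡ-≤ 3 m≤k*4 ⟩
  k * 4 + 3       <⟨ n<1+n _ ⟩
  1 + (k * 4 + 3) ≡⟨ cong suc (+-comm (k * 4) 3) ⟩
  4 + k * 4       ∎))
  where open ≤-Reasoning

m/n≡o⇒o*n≤m<n+o*n : ∀ {m o} n .{{_ : NonZero n}} → m / n ≡ o → o * n ≤ m × m < n + o * n
m/n≡o⇒o*n≤m<n+o*n {m} n refl = m/n*n≤m m n , (begin-strict
  m                  ≡⟨ m≡m%n+[m/n]*n m n ⟩
  m % n + m / n * n  <⟨ +-monoˡ-< (m / n * n) (m%n<n m n) ⟩
  n + m / n * n      ∎)
  where open ≤-Reasoning

applyUpTo-++ : ∀ {A : Set} (f : ℕ → A) m k → applyUpTo f (m + k) ≡ applyUpTo f m ++ applyUpTo (f ∘ (m +_)) k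
applyUpTo-++ f zero    k = refl
applyUpTo-++ f (suc m) k = cong (f 0 ∷_) (applyUpTo-++ (f ∘ suc) m k)

tabulate-toℕ : ∀ {A : Set} k (f : ℕ → A) → tabulate {n = k} (f ∘ toℕ) ≡ applyUpTo f k
tabulate-toℕ zero    f = refl
tabulate-toℕ (suc k) f = cong (f 0 ∷_) (tabulate-toℕ k (f ∘ suc))

liftVertex : ∀ {s} {n : Fin (suc s) → ℕ} → Vertex s (n ∘ suc) → Vertex (suc s) n
liftVertex (j , i) = suc j , i

vertices-suc : ∀ s (n : Fin (suc s) → ℕ) →
  vertices (suc s) n ≡ map (zero ,_) (allFin (n zero)) ++ map liftVertex (vertices s (n ∘ suc))
vertices-suc s n = cong (map (zero ,_) (allFin (n zero)) ++_) (begin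
  concat (map part (tabulate suc))                 ≡⟨ cong concat (map-tabulate suc part) ⟩
  concat (tabulate (part ∘ suc))                   ≡⟨ cong concat (map-tabulate id (part ∘ suc)) ⟨
  concat (map (part ∘ suc) (allFin s))             ≡⟨ cong concat (map-cong (λ j → map-∘ (allFin (n (suc j)))) (allFin s)) ⟩
  concat (map (map liftVertex ∘ part′) (allFin s)) ≡⟨ map-concatMap liftVertex part′ (allFin s) ⟨
  map liftVertex (vertices s (n ∘ suc))            ∎)
  where
  open ≡-Reasoning
  part : (j : Fin (suc s)) → List (Vertex (suc s) n)
  part j = map (j ,_) (allFin (n j))
  part′ : (j : Fin s) → List (Vertex s (n ∘ suc))
  part′ j = map (j ,_) (allFin (n (suc j)))

index : ∀ {s} {n : Fin s → ℕ} → Vertex s n → ℕ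
index {suc s}     (zero  , i) = toℕ i
index {suc s} {n} (suc j , i) = n zero + index {n = n ∘ suc} (j , i)

index<∑ : ∀ {s} {n : Fin s → ℕ} (v : Vertex s n) → index v < ∑ n
index<∑ {suc s} {n} (zero  , i) = ≤-trans (toℕ<n i) (m≤m+n (n zero) _)
index<∑ {suc s} {n} (suc j , i) = +-monoʳ-< (n zero) (index<∑ {n = n ∘ suc} (j , i))

map-index : ∀ s (n : Fin s → ℕ) {A : Set} (f : ℕ → A) →
  map (f ∘ index) (vertices s n) ≡ applyUpTo f (∑ n)
map-index zero    n f = refl
map-index (suc s) n {A} f = begin
  map F (vertices (suc s) n)                                ≡⟨ cong (map F) (vertices-suc s n) ⟩
  map F (map (zero ,_) (allFin (n zero)) ++ map liftVertex V) ≡⟨ map-++ F (map (zero ,_) (allFin (n zero))) _ ⟩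
  map F (map (zero ,_) (allFin (n zero))) ++ map F (map liftVertex V)
    ≡⟨ cong₂ _++_ (map-∘ {g = F} {f = zero ,_} (allFin (n zero))) (map-∘ {g = F} {f = liftVertex} V) ⟨
  map (f ∘ toℕ) (allFin (n zero)) ++ map (f ∘ (n zero +_) ∘ index) V
    ≡⟨ cong₂ _++_ (trans (map-tabulate id (f ∘ toℕ)) (tabulate-toℕ (n zero) f))
                  (map-index s (n ∘ suc) (f ∘ (n zero +_))) ⟩
  applyUpTo f (n zero) ++ applyUpTo (f ∘ (n zero +_)) (∑ (n ∘ suc)) ≡⟨ applyUpTo-++ f (n zero) (∑ (n ∘ suc)) ⟨
  applyUpTo f (∑ n)                                         ∎
  where
  open ≡-Reasoning
  F : Vertex (suc s) n → A
  F = f ∘ index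
  V : List (Vertex s (n ∘ suc))
  V = vertices s (n ∘ suc)

length-vertices : ∀ s (n : Fin s → ℕ) → length (vertices s n) ≡ totalSize s n
length-vertices s n = begin
  length (vertices s n)              ≡⟨ length-map index (vertices s n) ⟨
  length (map index (vertices s n))  ≡⟨ cong length (map-index s n id) ⟩
  length (upTo (∑ n))                ≡⟨ length-applyUpTo id (∑ n) ⟩
  ∑ n                                ≡⟨ sum-map-allFin s n ⟨
  totalSize s n                      ∎
  where open ≡-Reasoning

length-filter-vertices : ∀ s (n : Fin s → ℕ) {P : Vertex s n → Set} (P? : Decidable P) →
  length (filter P? (vertices s n)) ≡ ∑ (λ j → length (filter (λ i → P? (j , i)) (allFin (n j))))
length-filter-vertices zero    n P? = refl
length-filter-vertices (suc s) n P? = begin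
  length (filter P? (vertices (suc s) n))
    ≡⟨ cong (length ∘ filter P?) (vertices-suc s n) ⟩
  length (filter P? (map (zero ,_) (allFin (n zero)) ++ map liftVertex (vertices s (n ∘ suc))))
    ≡⟨ length-filter-++ P? (map (zero ,_) (allFin (n zero))) _ ⟩
  length (filter P? (map (zero ,_) (allFin (n zero)))) + length (filter P? (map liftVertex (vertices s (n ∘ suc))))
    ≡⟨ cong₂ _+_ (length-filter-map P? (zero ,_) (allFin (n zero))) (length-filter-map P? liftVertex (vertices s (n ∘ suc))) ⟩
  length (filter (P? ∘ (zero ,_)) (allFin (n zero))) + length (filter (P? ∘ liftVertex) (vertices s (n ∘ suc)))
    ≡⟨ cong (length (filter (P? ∘ (zero ,_)) (allFin (n zero))) +_) (length-filter-vertices s (n ∘ suc) (P? ∘ liftVertex)) ⟩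
  ∑ (λ j → length (filter (λ i → P? (j , i)) (allFin (n j))))
    ∎
  where open ≡-Reasoning

module _ {s : ℕ} {n : Fin s → ℕ} {k : ℕ} (f : Vertex s n → Fin k) where

  classSize : Fin k → ℕ
  classSize c = length (filter (λ v → f v ≟ᶠ c) (vertices s n))

  partClassSize : Fin k → Fin s → ℕ
  partClassSize c j = length (filter (λ i → f (j , i) ≟ᶠ c) (allFin (n j)))

  classSize≡∑partClassSize : ∀ c → classSize c ≡ ∑ (partClassSize c)
  classSize≡∑partClassSize c = length-filter-vertices s n (λ v → f v ≟ᶠ c)

  partClassSize≤ : ∀ c j → partClassSize c j ≤ n j
  partClassSize≤ c j = ≤-trans (length-filter _ (allFin (n j))) (≤-reflexive (length-tabulate id))

  totalSize≡∑classSize : totalSize s n ≡ ∑ classSize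
  totalSize≡∑classSize = trans (sym (length-vertices s n)) (length≡∑-fibres f (vertices s n))

  classSize-split : ∀ u → classSize (f u) ≡ sameColourNeighbours s n f u + partClassSize (f u) (proj₁ u)
  classSize-split u@(ju , _) = begin
    classSize c                                       ≡⟨ classSize≡∑partClassSize c ⟩
    ∑ (partClassSize c)                               ≡⟨ +-identityʳ _ ⟨
    ∑ (partClassSize c) + 0                           ≡⟨ cong (∑ (partClassSize c) +_) outside-own-part ⟨
    ∑ (partClassSize c) + outside ju                  ≡⟨ ∑-differ-at ju agree ⟨
    ∑ outside + partClassSize c ju                    ≡⟨ cong (_+ partClassSize c ju) (length-filter-vertices s n _) ⟨
    sameColourNeighbours s n f u + partClassSize c ju ∎
    where
    open ≡-Reasoning
    c : Fin k
    c = f u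
    outside : Fin s → ℕ
    outside j = length (filter (λ i → ¬? (ju ≟ᶠ j) ×-dec (f (j , i) ≟ᶠ c)) (allFin (n j)))
    outside-own-part : outside ju ≡ 0
    outside-own-part = cong length (filter-none _ (universal (λ _ p → proj₁ p refl) (allFin (n ju))))
    agree : ∀ j → j ≢ ju → outside j ≡ partClassSize c j
    agree j j≢ju = cong length (filter-≐ _ _ (proj₂ , λ same → (j≢ju ∘ sym) , same) (allFin (n j)))

  classSize≤4⇒relaxed : (∀ c → classSize c ≤ 4) → Is3RelaxedColouring s n k f
  classSize≤4⇒relaxed small u@(ju , iu) = s≤s⁻¹ (begin
    1 + sameColourNeighbours s n f u                             ≡⟨ +-comm 1 _ ⟩
    sameColourNeighbours s n f u + 1                             ≤⟨ +-monoʳ-≤ _ own-part-nonempty ⟩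
    sameColourNeighbours s n f u + partClassSize (f u) ju        ≡⟨ classSize-split u ⟨
    classSize (f u)                                              ≤⟨ small (f u) ⟩
    4                                                            ∎)
    where
    open ≤-Reasoning
    own-part-nonempty : 1 ≤ partClassSize (f u) ju
    own-part-nonempty = filter-some (λ i → f (ju , i) ≟ᶠ f u) (lose (∈-allFin iu) refl)

module _ {s : ℕ} {n : Fin s → ℕ} (n≤2 : ∀ j → n j ≤ 2)
         {k : ℕ} {f : Vertex s n → Fin k} (relaxed : Is3RelaxedColouring s n k f) where

  classSize≤3+partClassSize : ∀ {c} u → f u ≡ c → classSize f c ≤ 3 + partClassSize f c (proj₁ u)
  classSize≤3+partClassSize u refl = begin
    classSize f (f u)                                             ≡⟨ classSize-split f u ⟩
    sameColourNeighbours s n f u + partClassSize f (f u) (proj₁ u) ≤⟨ +-monoˡ-≤ _ (relaxed u) ⟩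
    3 + partClassSize f (f u) (proj₁ u)                           ∎
    where open ≤-Reasoning

  no-class-of-size≥5 : ∀ c → ¬ 5 ≤ classSize f c
  no-class-of-size≥5 c five = from-no (2 ∣? 5) (subst (2 ∣_) (≤-antisym at-most-5 five) even)
    where
    part-even : ∀ j → 2 ∣ partClassSize f c j
    part-even j = 2∣-of-≤2 (≤-trans (partClassSize≤ f c j) (n≤2 j)) λ nonempty →
      let (i , fji≡c) = satisfied (filter-some⁻ _ (allFin (n j)) nonempty)
      in  +-cancelˡ-≤ 3 _ _ (≤-trans five (classSize≤3+partClassSize (j , i) fji≡c))
    even : 2 ∣ classSize f c
    even = subst (2 ∣_) (sym (classSize≡∑partClassSize f c)) (∣-∑ (partClassSize f c) part-even)
    at-most-5 : classSize f c ≤ 5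
    at-most-5 =
      let (u , fu≡c) = satisfied (filter-some⁻ _ (vertices s n) (≤-trans (s≤s z≤n) five))
      in  ≤-trans (classSize≤3+partClassSize u fu≡c)
                  (+-monoʳ-≤ 3 (≤-trans (partClassSize≤ f c (proj₁ u)) (n≤2 (proj₁ u))))

  relaxed⇒totalSize≤ : totalSize s n ≤ k * 4
  relaxed⇒totalSize≤ = ≤-trans (≤-reflexive (totalSize≡∑classSize f))
                               (∑-≤-* (classSize f) (≮⇒≥ ∘ no-class-of-size≥5))

module _ (s : ℕ) (n : Fin s → ℕ) where

  index/4<ceil4 : (v : Vertex s n) → index v / 4 < ceil4 (totalSize s n)
  index/4<ceil4 v = m<n*o⇒m/o<n (begin-strict
    index v                 <⟨ index<∑ v ⟩
    ∑ n                     ≡⟨ sum-map-allFin s n ⟨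
    totalSize s n           ≤⟨ ≤ceil4*4 (totalSize s n) ⟩
    ceil4 (totalSize s n) * 4 ∎)
    where open ≤-Reasoning

  blockColouring : Vertex s n → Fin (ceil4 (totalSize s n))
  blockColouring v = fromℕ< (index/4<ceil4 v)

  blockColouring-classSize≤4 : ∀ c → classSize blockColouring c ≤ 4
  blockColouring-classSize≤4 c = begin
    classSize blockColouring c                                 ≡⟨ cong length (filter-≐ _ _ same-block (vertices s n)) ⟩
    length (filter (λ v → index v / 4 ≟ toℕ c) (vertices s n))  ≡⟨ length-filter-map (λ r → r / 4 ≟ toℕ c) index (vertices s n) ⟨
    length (filter (λ r → r / 4 ≟ toℕ c) (map index (vertices s n)))
                                                               ≡⟨ cong (length ∘ filter (λ r → r / 4 ≟ toℕ c)) (map-index s n id) ⟩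
    length (filter (λ r → r / 4 ≟ toℕ c) (upTo (∑ n)))           ≤⟨ length-filter-applyUpTo-≤ (λ r → r / 4 ≟ toℕ c) id (∑ n) _ _
                                                                    (λ i → m/n≡o⇒o*n≤m<n+o*n 4) ⟩
    4 + toℕ c * 4 ∸ toℕ c * 4                                  ≡⟨ m+n∸n≡m 4 (toℕ c * 4) ⟩
    4                                                          ∎
    where
    open ≤-Reasoning
    same-block : (λ v → blockColouring v ≡ c) ≐ (λ v → index v / 4 ≡ toℕ c)
    same-block = (λ {v} e → trans (sym (toℕ-fromℕ< (index/4<ceil4 v))) (cong toℕ e))
               , (λ {v} e → toℕ-injective (trans (toℕ-fromℕ< (index/4<ceil4 v)) e))

  blockColouring-relaxed : Is3RelaxedColouring s n (ceil4 (totalSize s n)) blockColouring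
  blockColouring-relaxed = classSize≤4⇒relaxed blockColouring blockColouring-classSize≤4

lemma5p6 : (s : ℕ) → 2 ≤ s → (n : Fin s → ℕ) → (∀ j → 1 ≤ n j × n j ≤ 2) →
    Chi3≡ s n (ceil4 (totalSize s n))
lemma5p6 s _ n sizes =
    (blockColouring s n , blockColouring-relaxed s n)
  , λ m m<ceil4 (f , relaxed) →
      <⇒≱ m<ceil4 (ceil4-least (relaxed⇒totalSize≤ (proj₂ ∘ sizes) relaxed))
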